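{- Assume the Dickson--Hardy--Littlewood conjecture: every admissible tuple of natural numbers is prime-producing. Let $k \geq 1$. Then any good $k$-tuple $(p_1,\dots,p_k)$ can be extended to a good $(k+1)$-tuple $(p_1,\dots,p_k,p_{k+1})$.
   Context: A tuple $(h_1,\dots,h_k)$ of natural numbers is admissible if for each prime $p$ there is at least one residue class mod $p$ containing none of $h_1,\dots,h_k$; it is prime-producing if there are infinitely many integers $n$ with $n+h_1,\dots,n+h_k$ all prime. For $k \geq 1$, a good $k$-tuple is a $k$-tuple $(p_1,\dots,p_k)$ of primes with $3 < p_1 < \dots < p_k$ such that for all $1 \leq i < j \leq k$, the number $p_i+p_j+1$ is prime and $p_i$ does not divide $p_j+2$. -}

module Defs where

open import Data.Nat using (ℕ; zero; suc; _+_; _<_; _≤_)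
open import Data.Nat.DivMod using (_%_)
open import Data.Nat.Divisibility using (_∣_)
open import Data.Nat.Primality using (Prime; prime⇒nonZero)
open import Data.Fin using (Fin; zero; _<_)
open import Data.Vec using (Vec; lookup)
open import Data.Product using (Σ; _×_; ∃)
open import Relation.Nullary using (¬_)
open import Relation.Binary.PropositionalEquality using (_≢_)

Admissible : {k : ℕ} → Vec ℕ k → Set
Admissible {k} h =
  (p : ℕ) → (pp : Prime p) →
  ∃ λ r → r Data.Nat.< p × ((i : Fin k) → (lookup h i % p) {{prime⇒nonZero pp}} ≢ r)

PrimeProducing : {k : ℕ} → Vec ℕ k → Set
PrimeProducing {k} h =
  (N : ℕ) → ∃ λ n → N ≤ n × ((i : Fin k) → Prime (n + lookup h i))

DHL : Set
DHL = (k : ℕ) (h : Vec ℕ k) → Admissible h → PrimeProducing h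

Good : {k : ℕ} → Vec ℕ k → Set
Good {k} ps =
  ((i : Fin k) → Prime (lookup ps i)) ×
  ((i : Fin k) → 3 Data.Nat.< lookup ps i) ×
  ((i j : Fin k) → i Data.Fin.< j →
      (lookup ps i Data.Nat.< lookup ps j) ×
      Prime (lookup ps i + lookup ps j + 1) ×
      ¬ (lookup ps i ∣ lookup ps j + 2))

{-# OPTIONS --safe #-}
-- By the conjecture applied to the tuple (0, 2, p₁+1, …, pₖ+1) there is a prime
-- n > pₖ such that n + 2 and every n + pᵢ + 1 are prime; then pₖ₊₁ = n works,
-- because pᵢ cannot divide the prime n + 2 > pᵢ. For admissibility at a prime p:
-- if p is none of the pᵢ, the residue 1 is missed. If p = pⱼ, the residue -1 is
-- missed unless p ∣ pᵢ + 2 for some i, and 3 is missed unless some pₘ ≡ 2.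
-- Otherwise -2 is missed: p ∣ pₗ + 3 with l ≠ m makes p divide, hence equal, the
-- prime pₗ + pₘ + 1 > pₘ, while l = m forces p = 5 and a prime pᵢ between 3 and 5.
module Submission where

open import Defs
open import Data.Nat using (ℕ; suc; _≥_)
open import Data.Vec using (Vec; _∷ʳ_)
open import Data.Product using (∃)

open import Algebra.Properties.CommutativeSemigroup using (xy∙z≈xz∙y)
open import Data.Fin as Fin using (Fin; zero; suc; toℕ; inject₁; fromℕ)
open import Data.Fin.Properties using (any?; toℕ-inject₁; toℕ-fromℕ; toℕ≤pred[n])
  renaming (_≟_ to _≟ᶠ_; <-cmp to <-cmpᶠ)
open import Data.Nat using (zero; _+_; _*_; _∸_; _<_; _≤_; NonZero; z≤n; s≤s; z<s; nonTrivial⇒n>1)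
open import Data.Nat.DivMod using (_%_; _/_; m≡m%n+[m/n]*n; m<n⇒m%n≡m; m%n%n≡m%n; [m+kn]%n≡m%n; %-distribˡ-+)
open import Data.Nat.Divisibility
open import Data.Nat.Primality
open import Data.Nat.Properties
open import Data.Product using (_×_; _,_; proj₁; proj₂)
open import Data.Sum using (inj₁; inj₂)
open import Data.Vec using ([]; _∷_; lookup; map; sum)
open import Data.Vec.Properties using (lookup-map)
open import Function using (case_of_)
open import Relation.Binary using (tri<; tri≈; tri>)
open import Relation.Binary.PropositionalEquality
open import Relation.Nullary using (¬_; yes; no; contradiction)
open import Relation.Nullary.Decidable using (from-yes)

module _ {p : ℕ} .{{_ : NonZero p}} where

  %≡⇒≡+/* : ∀ {m r} → m % p ≡ r → m ≡ r + (m / p) * p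
  %≡⇒≡+/* {m} refl = m≡m%n+[m/n]*n m p

  %≡⇒%≡% : ∀ {m r} → m % p ≡ r → m % p ≡ r % p
  %≡⇒%≡% {m} eq = trans (sym (m%n%n≡m%n m p)) (cong (_% p) eq)

  %≡⇒≡ : ∀ {m r} → m < p → m % p ≡ r → m ≡ r
  %≡⇒≡ m<p eq = trans (sym (m<n⇒m%n≡m m<p)) eq

  [m+n]%p≡m⇒p∣n : ∀ {m n} → (m + n) % p ≡ m → p ∣ n
  [m+n]%p≡m⇒p∣n {m} {n} eq = divides ((m + n) / p) (+-cancelˡ-≡ m n _ (%≡⇒≡+/* eq))

  m%p≡p∸n⇒p∣m+n : ∀ {m n} → n ≤ p → m % p ≡ p ∸ n → p ∣ m + n
  m%p≡p∸n⇒p∣m+n {m} {n} n≤p eq = divides (suc (m / p)) (begin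
    m + n                    ≡⟨ cong (_+ n) (%≡⇒≡+/* eq) ⟩
    p ∸ n + (m / p) * p + n  ≡⟨ xy∙z≈xz∙y +-commutativeSemigroup (p ∸ n) _ n ⟩
    p ∸ n + n + (m / p) * p  ≡⟨ cong (_+ (m / p) * p) (m∸n+n≡m n≤p) ⟩
    p + (m / p) * p          ∎)
    where open ≡-Reasoning

  [1+m]%p≡1+r⇒m%p≡r : ∀ {m r} → r < p → suc m % p ≡ suc r → m % p ≡ r
  [1+m]%p≡1+r⇒m%p≡r {m} {r} r<p eq = begin
    m % p                      ≡⟨ cong (_% p) (suc-injective (%≡⇒≡+/* eq)) ⟩
    (r + (suc m / p) * p) % p  ≡⟨ [m+kn]%n≡m%n r (suc m / p) p ⟩
    r % p                      ≡⟨ m<n⇒m%n≡m r<p ⟩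
    r                          ∎
    where open ≡-Reasoning

  ∣m+n⇒∣m+o : ∀ m {n o} → n % p ≡ o % p → p ∣ m + n → p ∣ m + o
  ∣m+n⇒∣m+o m {n} {o} n≡o p∣m+n = m%n≡0⇒n∣m (m + o) p (begin
    (m + o) % p          ≡⟨ %-distribˡ-+ m o p ⟩
    (m % p + o % p) % p  ≡⟨ cong (λ x → (m % p + x) % p) n≡o ⟨
    (m % p + n % p) % p  ≡⟨ %-distribˡ-+ m n p ⟨
    (m + n) % p          ≡⟨ n∣m⇒m%n≡0 (m + n) p p∣m+n ⟩
    0                    ∎)
    where open ≡-Reasoning

prime∣prime⇒≡ : ∀ {d q} → Prime d → Prime q → d ∣ q → d ≡ q
prime∣prime⇒≡ d-prime q-prime d∣q with prime⇒irreducible q-prime d∣q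
... | inj₁ refl = contradiction d-prime ¬prime[1]
... | inj₂ d≡q  = d≡q

prime∣4⇒≡2 : ∀ {p} → Prime p → p ∣ 4 → p ≡ 2
prime∣4⇒≡2 p-prime p∣4 with euclidsLemma 2 2 p-prime p∣4
... | inj₁ p∣2 = prime∣prime⇒≡ p-prime prime[2] p∣2
... | inj₂ p∣2 = prime∣prime⇒≡ p-prime prime[2] p∣2

¬prime[3<_<5] : ∀ {q} → 3 < q → q < 5 → ¬ Prime q
¬prime[3<_<5] (s≤s (s≤s (s≤s (s≤s z≤n)))) (s≤s (s≤s (s≤s (s≤s (s≤s z≤n))))) 4-prime =
  prime⇒¬composite 4-prime composite[4]

prime[5] : Prime 5
prime[5] = from-yes (prime? 5)

lookup≤sum : ∀ {k} (xs : Vec ℕ k) i → lookup xs i ≤ sum xs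
lookup≤sum (x ∷ xs) zero    = m≤m+n x (sum xs)
lookup≤sum (x ∷ xs) (suc i) = ≤-trans (lookup≤sum xs i) (m≤n+m (sum xs) x)

data SnocView : ∀ {n} → Fin (suc n) → Set where
  old : ∀ {n} (i : Fin n) → SnocView (inject₁ i)
  new : ∀ {n} → SnocView (fromℕ n)

snocView : ∀ {n} (i : Fin (suc n)) → SnocView i
snocView {zero}  zero    = new
snocView {suc n} zero    = old zero
snocView {suc n} (suc i) with snocView i
... | old j = old (suc j)
... | new   = new

module _ {A : Set} where

  lookup-∷ʳ-inject₁ : ∀ {n} (xs : Vec A n) x i → lookup (xs ∷ʳ x) (inject₁ i) ≡ lookup xs i
  lookup-∷ʳ-inject₁ (y ∷ xs) x zero    = refl
  lookup-∷ʳ-inject₁ (y ∷ xs) x (suc i) = lookup-∷ʳ-inject₁ xs x i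

  lookup-∷ʳ-fromℕ : ∀ {n} (xs : Vec A n) x → lookup (xs ∷ʳ x) (fromℕ n) ≡ x
  lookup-∷ʳ-fromℕ []       x = refl
  lookup-∷ʳ-fromℕ (y ∷ xs) x = lookup-∷ʳ-fromℕ xs x

  ∀-lookup-∷ʳ : ∀ {n} (Q : A → Set) (xs : Vec A n) x →
    (∀ i → Q (lookup xs i)) → Q x → ∀ i → Q (lookup (xs ∷ʳ x) i)
  ∀-lookup-∷ʳ Q xs x Q-xs Q-x i with snocView i
  ... | old j = subst Q (sym (lookup-∷ʳ-inject₁ xs x j)) (Q-xs j)
  ... | new   = subst Q (sym (lookup-∷ʳ-fromℕ xs x)) Q-x

GoodPair : ℕ → ℕ → Set
GoodPair a b = a < b × Prime (a + b + 1) × ¬ a ∣ b + 2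

good-∷ʳ : ∀ {k} (ps : Vec ℕ k) {q} → Good ps → Prime q → 3 < q →
  (∀ i → GoodPair (lookup ps i) q) → Good (ps ∷ʳ q)
good-∷ʳ {k} ps {q} (primes , >3 , pairs) q-prime 3<q q-pairs =
  ∀-lookup-∷ʳ Prime ps q primes q-prime , ∀-lookup-∷ʳ (3 <_) ps q >3 3<q , pairs′
  where
  pairs′ : ∀ i j → i Fin.< j → GoodPair (lookup (ps ∷ʳ q) i) (lookup (ps ∷ʳ q) j)
  pairs′ i j i<j with snocView i | snocView j
  ... | old i′ | old j′ rewrite lookup-∷ʳ-inject₁ ps q i′ | lookup-∷ʳ-inject₁ ps q j′ =
    pairs i′ j′ (subst₂ _<_ (toℕ-inject₁ i′) (toℕ-inject₁ j′) i<j)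
  ... | old i′ | new rewrite lookup-∷ʳ-inject₁ ps q i′ | lookup-∷ʳ-fromℕ ps q =
    q-pairs i′
  ... | new | _ = contradiction (subst (_< toℕ j) (toℕ-fromℕ k) i<j) (≤⇒≯ (toℕ≤pred[n] j))

module GoodTuple {k} {ps : Vec ℕ k} (good : Good ps) where
  private
    P : Fin k → ℕ
    P = lookup ps

    pairs : ∀ i j → i Fin.< j → GoodPair (P i) (P j)
    pairs = proj₂ (proj₂ good)

  good-prime : ∀ i → Prime (P i)
  good-prime = proj₁ good

  good-< : ∀ {i j} → i Fin.< j → P i < P j
  good-< i<j = proj₁ (pairs _ _ i<j)

  good->3 : ∀ i → 3 < P i
  good->3 = proj₁ (proj₂ good)

  good-prime-sum : ∀ {l m} → l ≢ m → Prime (P l + P m + 1)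
  good-prime-sum {l} {m} l≢m with <-cmpᶠ l m
  ... | tri< l<m _ _ = let _ , prime-sum , _ = pairs l m l<m in prime-sum
  ... | tri≈ _ l≡m _ = contradiction l≡m l≢m
  ... | tri> _ _ m<l = let _ , prime-sum , _ = pairs m l m<l in
                       subst (λ n → Prime (n + 1)) (+-comm (P m) (P l)) prime-sum

  good-∣+2⇒< : ∀ {i j} → P j ∣ P i + 2 → i Fin.< j
  good-∣+2⇒< {i} {j} Pj∣Pi+2 with <-cmpᶠ i j
  ... | tri< i<j _ _  = i<j
  ... | tri≈ _ refl _ = contradiction (∣m+n∣m⇒∣n Pj∣Pi+2 ∣-refl) (>⇒∤ (<-trans (n<1+n 2) (good->3 j)))
  ... | tri> _ _ j<i  = let _ , _ , ∤ = pairs j i j<i in contradiction Pj∣Pi+2 ∤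

shifts : ∀ {k} → Vec ℕ k → Vec ℕ (2 + k)
shifts ps = 0 ∷ 2 ∷ map suc ps

module ShiftsAdmissible {k} {ps : Vec ℕ k} (good : Good ps) {p} (p-prime : Prime p) where
  private
    instance
      p≢0 : NonZero p
      p≢0 = prime⇒nonZero p-prime

    P : Fin k → ℕ
    P = lookup ps

  open GoodTuple {ps = ps} good

  AvoidedResidue : Set
  AvoidedResidue = ∃ λ r → r < p × ∀ i → lookup (shifts ps) i % p ≢ r

  avoiding : ∀ {r} → r < p → 0 % p ≢ r → 2 % p ≢ r → (∀ l → suc (P l) % p ≢ r) → AvoidedResidue
  avoiding {r} r<p 0≢r 2≢r P+1≢r = r , r<p , λ where
    zero          → 0≢r
    (suc zero)    → 2≢r
    (suc (suc l)) → subst (λ n → n % p ≢ r) (sym (lookup-map l suc ps)) (P+1≢r l)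

  avoiding-1 : (∀ m → ¬ p ∣ P m) → AvoidedResidue
  avoiding-1 p∤P = avoiding 1<p
    (λ 0≡1 → contradiction (%≡⇒≡ (<-trans z<s 1<p) 0≡1) λ ())
    (λ 2≡1 → >⇒∤ 1<p ([m+n]%p≡m⇒p∣n {m = 1} 2≡1))
    (λ l Pl+1≡1 → p∤P l ([m+n]%p≡m⇒p∣n {m = 1} Pl+1≡1))
    where 1<p = nonTrivial⇒n>1 p {{prime⇒nonTrivial p-prime}}

  avoiding-p∸1 : 3 < p → (∀ i → ¬ p ∣ P i + 2) → AvoidedResidue
  avoiding-p∸1 3<p p∤P+2 = avoiding (∸-monoʳ-< z<s 1≤p)
    (λ 0≡-1 → >⇒∤ (<-trans (n<1+n 1) 2<p) (m%p≡p∸n⇒p∣m+n 1≤p 0≡-1))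
    (λ 2≡-1 → >⇒∤ 3<p (m%p≡p∸n⇒p∣m+n 1≤p 2≡-1))
    (λ l Pl+1≡-1 → p∤P+2 l (subst (p ∣_) (sym (+-suc (P l) 1)) (m%p≡p∸n⇒p∣m+n 1≤p Pl+1≡-1)))
    where
    2<p = <-trans (n<1+n 2) 3<p
    1≤p = <-trans z<s 2<p

  avoiding-3 : 3 < p → (∀ m → P m % p ≢ 2) → AvoidedResidue
  avoiding-3 3<p P≢2 = avoiding 3<p
    (λ 0≡3 → contradiction (%≡⇒≡ (<-trans z<s 3<p) 0≡3) λ ())
    (λ 2≡3 → contradiction (%≡⇒≡ (<-trans (n<1+n 2) 3<p) 2≡3) λ ())
    (λ l Pl+1≡3 → P≢2 l ([1+m]%p≡1+r⇒m%p≡r (<-trans (n<1+n 2) 3<p) Pl+1≡3))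

  avoiding-p∸2 : 3 < p → (∀ l → ¬ p ∣ suc (P l) + 2) → AvoidedResidue
  avoiding-p∸2 3<p p∤P+3 = avoiding (∸-monoʳ-< z<s 2≤p)
    (λ 0≡-2 → >⇒∤ 2<p (m%p≡p∸n⇒p∣m+n 2≤p 0≡-2))
    (λ 2≡-2 → <⇒≢ 2<p (sym (prime∣4⇒≡2 p-prime (m%p≡p∸n⇒p∣m+n 2≤p 2≡-2))))
    (λ l Pl+1≡-2 → p∤P+3 l (m%p≡p∸n⇒p∣m+n 2≤p Pl+1≡-2))
    where
    2<p = <-trans (n<1+n 2) 3<p
    2≤p = <⇒≤ 2<p

  p∤Pm+3 : ∀ {i j m} → p ≡ P j → p ∣ P i + 2 → P m % p ≡ 2 → ¬ p ∣ suc (P m) + 2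
  p∤Pm+3 {i} {j} {m} p≡Pj p∣Pi+2 Pm≡2 p∣Pm+3 = p≢5 (prime∣prime⇒≡ p-prime prime[5] p∣5)
    where
    p∣5 : p ∣ 3 + 2
    p∣5 = ∣m+n⇒∣m+o 3 (%≡⇒%≡% {p = p} Pm≡2)
                    (subst (p ∣_) (cong suc (+-comm (P m) 2)) p∣Pm+3)
    p≢5 : p ≢ 5
    p≢5 p≡5 = ¬prime[3<_<5] (good->3 i)
      (subst (P i <_) (trans (sym p≡Pj) p≡5) (good-< (good-∣+2⇒< (subst (_∣ P i + 2) p≡Pj p∣Pi+2))))
      (good-prime i)

  p∤Pl+3 : ∀ {l m} → l ≢ m → P m % p ≡ 2 → ¬ p ∣ suc (P l) + 2
  p∤Pl+3 {l} {m} l≢m Pm≡2 p∣Pl+3 = <⇒≢ (<-trans (n<1+n 2) (good->3 m)) (sym (%≡⇒≡ Pm<p Pm≡2))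
    where
    p≡Pl+Pm+1 : p ≡ P l + P m + 1
    p≡Pl+Pm+1 = prime∣prime⇒≡ p-prime (good-prime-sum l≢m)
      (subst (p ∣_) (+-comm 1 (P l + P m))
        (∣m+n⇒∣m+o (suc (P l)) (sym (%≡⇒%≡% {p = p} Pm≡2)) p∣Pl+3))
    Pm<p : P m < p
    Pm<p = subst (P m <_) (sym p≡Pl+Pm+1) (≤-<-trans (m≤n+m (P m) (P l)) (m<m+n (P l + P m) z<s))

  avoidedResidue-at : ∀ {j} → p ≡ P j → 3 < p → AvoidedResidue
  avoidedResidue-at p≡Pj 3<p with any? (λ i → p ∣? P i + 2)
  ... | no p∤P+2 = avoiding-p∸1 3<p (λ i p∣Pi+2 → p∤P+2 (i , p∣Pi+2))
  ... | yes (i , p∣Pi+2) with any? (λ m → P m % p ≟ 2)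
  ...   | no P≢2 = avoiding-3 3<p (λ m Pm≡2 → P≢2 (m , Pm≡2))
  ...   | yes (m , Pm≡2) = avoiding-p∸2 3<p λ l → case l ≟ᶠ m of λ where
          (yes refl) → p∤Pm+3 p≡Pj p∣Pi+2 Pm≡2
          (no l≢m)   → p∤Pl+3 l≢m Pm≡2

  avoidedResidue : AvoidedResidue
  avoidedResidue with any? (λ j → p ∣? P j)
  ... | no p∤P = avoiding-1 (λ m p∣Pm → p∤P (m , p∣Pm))
  ... | yes (j , p∣Pj) = avoidedResidue-at p≡Pj (subst (3 <_) (sym p≡Pj) (good->3 j))
    where p≡Pj = prime∣prime⇒≡ p-prime (good-prime j) p∣Pj

shifts-admissible : ∀ {k} {ps : Vec ℕ k} → Good ps → Admissible (shifts ps)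
shifts-admissible good p p-prime = ShiftsAdmissible.avoidedResidue good p-prime

good-extension : DHL → ∀ {k} (ps : Vec ℕ k) → Good ps →
  ∃ λ q → Prime q × 3 < q × ∀ i → GoodPair (lookup ps i) q
good-extension dhl {k} ps good
  with dhl (2 + k) (shifts ps) (shifts-admissible good) (4 + sum ps)
... | n , 4+Σps≤n , primes = n , n-prime , 3<n , λ i → Pi<n i , Pi+n+1-prime i , Pi∤n+2 i
  where
  open GoodTuple {ps = ps} good

  n-prime : Prime n
  n-prime = subst Prime (+-identityʳ n) (primes zero)

  3<n : 3 < n
  3<n = ≤-trans (m≤m+n 4 (sum ps)) 4+Σps≤n

  Pi<n : ∀ i → lookup ps i < n
  Pi<n i = ≤-trans (s≤s (≤-trans (lookup≤sum ps i) (m≤n+m (sum ps) 3))) 4+Σps≤n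

  Pi+n+1-prime : ∀ i → Prime (lookup ps i + n + 1)
  Pi+n+1-prime i = subst Prime shift≡ (primes (suc (suc i)))
    where
    open ≡-Reasoning
    shift≡ : n + lookup (map suc ps) i ≡ lookup ps i + n + 1
    shift≡ = begin
      n + lookup (map suc ps) i  ≡⟨ cong (n +_) (lookup-map i suc ps) ⟩
      n + suc (lookup ps i)      ≡⟨ +-suc n (lookup ps i) ⟩
      suc (n + lookup ps i)      ≡⟨ cong suc (+-comm n (lookup ps i)) ⟩
      suc (lookup ps i + n)      ≡⟨ +-comm 1 (lookup ps i + n) ⟩
      lookup ps i + n + 1        ∎

  Pi∤n+2 : ∀ i → ¬ lookup ps i ∣ n + 2
  Pi∤n+2 i Pi∣n+2 = <⇒≢ (<-trans (Pi<n i) (m<m+n n z<s))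
                        (prime∣prime⇒≡ (good-prime i) (primes (suc zero)) Pi∣n+2)

proposition2p1 : DHL → (k : ℕ) → k ≥ 1 → (ps : Vec ℕ k) → Good ps →
    ∃ λ (q : ℕ) → Good (ps ∷ʳ q)
proposition2p1 dhl _ _ ps good with good-extension dhl ps good
... | q , q-prime , 3<q , q-pairs = q , good-∷ʳ ps good q-prime 3<q q-pairs
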